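{- Assume the standing setting below. Then: (a) for all $i,j\in[-k_2,k_1]^{*}$ with $i\ne j$, $\psi(i,j)=0$; (b) for all $m\in[-k_2,k_1]^{*}$ and all $i,j\in[-k_2,k_1]^{*}$, $\psi(m,i,j)=0$; (c) for every integer $m$, \[\psi(m,0)+\sum_{i\in[-k_2,k_1]^{*}}\psi(m,i)+\sum_{i,j\in[-k_2,k_1]^{*},\ i\le j}\psi(m,i,j)=n.\]
   Context: Standing setting: $k_1>k_2\ge 0$ and $n$ are integers, and $k_1+k_2+1$ is composite. $G$ is a finite abelian group written multiplicatively with identity $e$, of order $1+n(k_1+k_2)+\binom{n}{2}(k_1+k_2)^2$, and $T=\{t_1,\dots,t_n\}\subset G$ has $|T|=n$. Notation: for integers $a<b$, $[a,b]^{*}=\{i\ne 0: a\le i\le b\}$; $I=[-k_2,k_1]^{*}$; for an integer $i$, $T^{(i)}=\{t^i:t\in T\}$; for integers $i,j$, $S(i,j)=\{g^ih^j: g,h\in T,\ g\ne h\}$. It is assumed that $G$ is the disjoint union $\{e\}\cup\bigcup_{i\in I}T^{(i)}\cup\bigcup_{i,j\in I,\,i\le j}S(i,j)$; equivalently, in $\mathbb{Z}[G]$, $\sum_{g\in G}g=e+\sum_{i=1}^n\sum_{j\in I}t_i^j+\sum_{1\le i<j\le n}(\sum_{k\in I}t_i^k)(\sum_{l\in I}t_j^l)$ (this is the condition equivalent to a lattice tiling of $\mathbb{Z}^n$ by $\mathcal{B}(n,2,k_1,k_2)$). Counting functions: for integers $m,i,j$, $\psi(m,i,j)=|\{t\in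 T: t^m\in S(i,j)\}|$, $\psi(m,i)=|\{t\in T: t^m\in T^{(i)}\}|$, and $\psi(m,0)=|\{t\in T: t^m=e\}|$. -}

module Defs where

open import Data.Nat as ℕ using (ℕ; zero; suc)
open import Data.Integer as ℤ using (ℤ; +_; -[1+_])
open import Data.Fin using (Fin)
open import Data.Fin.Properties using (any?; _≟_; _<?_)
open import Data.List using (List; []; _∷_; _++_; map; concatMap; filter; upTo; allFin; length)
open import Data.Product using (_×_; _,_; ∃)
open import Relation.Nullary using (¬_; Dec; ¬?)
open import Relation.Nullary.Decidable using (_×-dec_)
open import Relation.Binary.PropositionalEquality using (_≡_; _≢_)
open import Algebra.Structures using (IsAbelianGroup)

-- A finite abelian group of order N, realised (up to isomorphism) on the
-- carrier Fin N with propositional equality; written multiplicatively.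
record FinAbGroup (N : ℕ) : Set where
  field
    _∙_ : Fin N → Fin N → Fin N
    e   : Fin N
    _⁻¹ : Fin N → Fin N
    isAbelianGroup : IsAbelianGroup _≡_ _∙_ e _⁻¹

InI : ℕ → ℕ → ℤ → Set
InI k₁ k₂ i = (ℤ.- (+ k₂) ℤ.≤ i) × (i ℤ.≤ + k₁) × (i ≢ + 0)

Ilist : ℕ → ℕ → List ℤ
Ilist k₁ k₂ = map (λ a → -[1+ a ]) (upTo k₂) ++ map (λ a → + suc a) (upTo k₁)

Ipairs : ℕ → ℕ → List (ℤ × ℤ)
Ipairs k₁ k₂ = concatMap (λ i → map (i ,_) (filter (i ℤ.≤?_) (Ilist k₁ k₂))) (Ilist k₁ k₂)

module Setting {N : ℕ} (G : FinAbGroup N) {n : ℕ} (t : Fin n → Fin N) where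
  open FinAbGroup G

  powℕ : Fin N → ℕ → Fin N
  powℕ g zero    = e
  powℕ g (suc k) = g ∙ powℕ g k

  _^_ : Fin N → ℤ → Fin N
  g ^ (+ k)    = powℕ g k
  g ^ -[1+ k ] = (powℕ g (suc k)) ⁻¹

  InTpow : ℤ → Fin N → Set
  InTpow i x = ∃ λ a → t a ^ i ≡ x

  inTpow? : ∀ i x → Dec (InTpow i x)
  inTpow? i x = any? (λ a → t a ^ i ≟ x)

  InS : ℤ → ℤ → Fin N → Set
  InS i j x = ∃ λ a → ∃ λ b → (a ≢ b) × ((t a ^ i) ∙ (t b ^ j) ≡ x)

  inS? : ∀ i j x → Dec (InS i j x)
  inS? i j x = any? (λ a → any? (λ b → ¬? (a ≟ b) ×-dec ((t a ^ i) ∙ (t b ^ j) ≟ x)))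

  ψ₃ : ℤ → ℤ → ℤ → ℕ
  ψ₃ m i j = length (filter (λ c → inS? i j (t c ^ m)) (allFin n))

  ψ₂ : ℤ → ℤ → ℕ
  ψ₂ m i = length (filter (λ c → inTpow? i (t c ^ m)) (allFin n))

  ψ₀ : ℤ → ℕ
  ψ₀ m = length (filter (λ c → t c ^ m ≟ e) (allFin n))

  -- The terms of e + Σ_i Σ_{j∈I} t_i^j + Σ_{i<j} (Σ_{k∈I} t_i^k)(Σ_{l∈I} t_j^l) in ℤ[G]
  tilingTerms : ℕ → ℕ → List (Fin N)
  tilingTerms k₁ k₂ =
    e ∷ (concatMap (λ a → map (t a ^_) (Ilist k₁ k₂)) (allFin n)
         ++ concatMap (λ a → concatMap (λ b →
              concatMap (λ k → map (λ l → (t a ^ k) ∙ (t b ^ l)) (Ilist k₁ k₂)) (Ilist k₁ k₂))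
              (filter (a <?_) (allFin n))) (allFin n))

{-# OPTIONS --safe #-}
-- The tiling hypothesis says that e, the powers t_a^k (k ∈ I) and the
-- products t_a^k t_b^l (a < b, k, l ∈ I) enumerate G without repetition, so
-- every element of G has exactly one such representation (a product with a > b
-- being rewritten by commutativity).  Hence a power t_c^i with i ∈ I determines
-- i, which gives (a); a power t_c^m with m ∈ I is never a product of powers of
-- two distinct generators, which gives (b); and every element of G lies in
-- exactly one of {e}, T^(i), S(i,j) with i ≤ j, so summing over the n elements
-- t_c^m and exchanging the order of summation gives (c).
module Submission where

open import Defs
open import Data.Nat using (ℕ; _+_; _*_; _^_; _<_)
open import Data.Nat.Primality using (Composite)
open import Data.Nat.Combinatorics using (_C_)
open import Data.Integer using (ℤ)
open import Data.Fin using (Fin)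
open import Data.List using (map; allFin)
open import Data.Nat.ListAction using (sum)
open import Data.List.Relation.Binary.Permutation.Propositional using (_↭_)
open import Data.Product using (_×_; _,_; proj₁; proj₂)
open import Function.Definitions using (Injective)
open import Relation.Binary.PropositionalEquality using (_≡_; _≢_)

open import Data.Nat using (zero; suc; s≤s)
open import Data.Nat.Properties using (suc-injective; +-commutativeSemigroup)
open import Algebra.Properties.CommutativeSemigroup +-commutativeSemigroup
  renaming (interchange to +-interchange)
open import Algebra.Structures using (IsAbelianGroup)
open import Data.Empty using (⊥-elim)
open import Data.Fin as Fin using (_<?_)
import Data.Fin.Properties as Fin
open import Data.Integer as ℤ using (+_; -[1+_]; +≤+; -≤-)
import Data.Integer.Properties as ℤ
open import Data.List using (List; []; _∷_; _++_; concatMap; filter; length; upTo)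
open import Data.List.Properties
  using (map-cong; map-∘; map-++; map-concatMap; concatMap-cong; length-tabulate; filter-none)
open import Data.List.Membership.Propositional using (_∈_; find; lose)
open import Data.List.Membership.Propositional.Properties
  using (∈-++⁺ˡ; ∈-++⁺ʳ; ∈-++⁻; ∈-map⁺; ∈-map⁻; ∈-filter⁺; ∈-filter⁻; ∈-allFin; ∈-upTo⁺;
         ∈-concatMap⁺; ∈-concatMap⁻)
open import Data.List.Relation.Unary.Any using (here; there)
import Data.List.Relation.Unary.All as All
import Data.List.Relation.Unary.All.Properties as All
open import Data.List.Relation.Unary.AllPairs as AllPairs using (_∷_)
import Data.List.Relation.Unary.AllPairs.Properties as AllPairs
open import Data.List.Relation.Unary.Unique.Propositional using (Unique)
open import Data.List.Relation.Binary.Disjoint.Propositional using (Disjoint)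
import Data.List.Relation.Unary.Unique.Propositional.Properties as Unique
open import Data.List.Relation.Binary.Permutation.Propositional using (↭-sym; ↭⇒↭ₛ)
open import Data.List.Relation.Binary.Permutation.Propositional.Properties using (∈-resp-↭)
import Data.List.Relation.Binary.Permutation.Setoid.Properties as Permutationₛ
open import Data.Product using (∃; ∃₂)
open import Data.Sum using (_⊎_; inj₁; inj₂)
open import Data.Unit using (⊤; tt)
open import Function using (_∘_; id)
open import Level using (0ℓ)
open import Relation.Binary using (tri<; tri≈; tri>)
open import Relation.Binary.PropositionalEquality
  using (refl; sym; trans; cong; cong₂; subst; setoid; module ≡-Reasoning)
open import Relation.Nullary using (¬_; Dec; yes; no)
open import Relation.Unary using (Pred; Decidable)

indicator : {P : Set} → Dec P → ℕ
indicator (yes _) = 1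
indicator (no  _) = 0

indicator-yes : {P : Set} → P → (P? : Dec P) → indicator P? ≡ 1
indicator-yes p (yes _) = refl
indicator-yes p (no ¬p) = ⊥-elim (¬p p)

indicator-no : {P : Set} → ¬ P → (P? : Dec P) → indicator P? ≡ 0
indicator-no ¬p (yes p) = ⊥-elim (¬p p)
indicator-no ¬p (no _)  = refl

module _ {A : Set} where

  Unique-resp-↭ : {xs ys : List A} → xs ↭ ys → Unique xs → Unique ys
  Unique-resp-↭ p = Permutationₛ.Unique-resp-↭ (setoid A) (↭⇒↭ₛ p)

  Unique-map⇒injectiveOn : ∀ {B : Set} (f : A → B) {xs u v} → Unique (map f xs) →
    u ∈ xs → v ∈ xs → f u ≡ f v → u ≡ v
  Unique-map⇒injectiveOn f (_ ∷ _)   (here refl) (here refl) _  = refl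
  Unique-map⇒injectiveOn f (fx∉ ∷ _) (here refl) (there v∈)  eq = ⊥-elim (All.lookup fx∉ (∈-map⁺ f v∈) eq)
  Unique-map⇒injectiveOn f (fx∉ ∷ _) (there u∈)  (here refl) eq = ⊥-elim (All.lookup fx∉ (∈-map⁺ f u∈) (sym eq))
  Unique-map⇒injectiveOn f (_ ∷ un)  (there u∈)  (there v∈)  eq = Unique-map⇒injectiveOn f un u∈ v∈ eq

  sum-map-+ : (f g : A → ℕ) (xs : List A) →
    sum (map (λ x → f x + g x) xs) ≡ sum (map f xs) + sum (map g xs)
  sum-map-+ f g []       = refl
  sum-map-+ f g (x ∷ xs) = trans (cong (_+_ (f x + g x)) (sum-map-+ f g xs))
                                 (+-interchange (f x) (g x) (sum (map f xs)) (sum (map g xs)))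

  sum-map-zero : (xs : List A) → sum (map (λ _ → 0) xs) ≡ 0
  sum-map-zero []       = refl
  sum-map-zero (_ ∷ xs) = sum-map-zero xs

  sum-map-one : {f : A → ℕ} → (∀ x → f x ≡ 1) → (xs : List A) → sum (map f xs) ≡ length xs
  sum-map-one f≡1 []       = refl
  sum-map-one f≡1 (x ∷ xs) = cong₂ _+_ (f≡1 x) (sum-map-one f≡1 xs)

  module _ {P : Pred A 0ℓ} (P? : Decidable P) where

    length-filter≡sum-indicator : (xs : List A) →
      length (filter P? xs) ≡ sum (map (indicator ∘ P?) xs)
    length-filter≡sum-indicator []       = refl
    length-filter≡sum-indicator (x ∷ xs) with P? x
    ... | yes _ = cong suc (length-filter≡sum-indicator xs)
    ... | no  _ = length-filter≡sum-indicator xs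

    length-filter-none : ∀ {xs} → (∀ {y} → y ∈ xs → ¬ P y) → length (filter P? xs) ≡ 0
    length-filter-none ¬P = cong length (filter-none P? (All.tabulate ¬P))

    length-filter-unique : ∀ {xs c} → Unique xs → c ∈ xs → P c →
      (∀ {y} → y ∈ xs → P y → y ≡ c) → length (filter P? xs) ≡ 1
    length-filter-unique {x ∷ xs} (x∉ ∷ un) c∈ Pc only with P? x | c∈
    ... | yes Px | _ = cong suc (length-filter-none λ y∈ Py →
                         All.lookup x∉ y∈ (trans (only (here refl) Px) (sym (only (there y∈) Py))))
    ... | no ¬Px | here refl = ⊥-elim (¬Px Pc)
    ... | no _   | there c∈′ = length-filter-unique un c∈′ Pc (only ∘ there)

module _ {A B : Set} where

  map-concatMap-cong : ∀ {C : Set} (h : B → C) {f : A → List B} {g : A → List C} →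
    (∀ x → map h (f x) ≡ g x) → ∀ xs → map h (concatMap f xs) ≡ concatMap g xs
  map-concatMap-cong h {f} h∘f≗g xs = trans (map-concatMap h f xs) (concatMap-cong h∘f≗g xs)

  sum-map-comm : (h : A → B → ℕ) (xs : List A) (ys : List B) →
    sum (map (λ x → sum (map (h x) ys)) xs) ≡ sum (map (λ y → sum (map (λ x → h x y) xs)) ys)
  sum-map-comm h []       ys = sym (sum-map-zero ys)
  sum-map-comm h (x ∷ xs) ys =
    trans (cong (_+_ (sum (map (h x) ys))) (sum-map-comm h xs ys))
          (sym (sum-map-+ (h x) (λ y → sum (map (λ x → h x y) xs)) ys))

  sum-length-filter-comm : {R : A → B → Set} (R? : ∀ x y → Dec (R x y)) (xs : List A) (ys : List B) →
    sum (map (λ x → length (filter (R? x) ys)) xs)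
      ≡ sum (map (λ y → length (filter (λ x → R? x y) xs)) ys)
  sum-length-filter-comm R? xs ys = begin
    sum (map (λ x → length (filter (R? x) ys)) xs)
      ≡⟨ cong sum (map-cong (λ x → length-filter≡sum-indicator (R? x) ys) xs) ⟩
    sum (map (λ x → sum (map (λ y → indicator (R? x y)) ys)) xs)
      ≡⟨ sum-map-comm (λ x y → indicator (R? x y)) xs ys ⟩
    sum (map (λ y → sum (map (λ x → indicator (R? x y)) xs)) ys)
      ≡⟨ cong sum (map-cong (λ y → length-filter≡sum-indicator (λ x → R? x y) xs) ys) ⟨
    sum (map (λ y → length (filter (λ x → R? x y) xs)) ys) ∎
    where open ≡-Reasoning

InI⇒∈Ilist : ∀ {k₁ k₂ i} → InI k₁ k₂ i → i ∈ Ilist k₁ k₂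
InI⇒∈Ilist {i = + zero}             (_ , _ , i≢0)      = ⊥-elim (i≢0 refl)
InI⇒∈Ilist {k₂ = k₂} {+ suc a}      (_ , +≤+ a<k₁ , _) =
  ∈-++⁺ʳ (map -[1+_] (upTo k₂)) (∈-map⁺ (λ a → + suc a) (∈-upTo⁺ a<k₁))
InI⇒∈Ilist {k₂ = suc k₂} { -[1+ a ]} (-≤- a<k₂ , _ , _) =
  ∈-++⁺ˡ (∈-map⁺ -[1+_] (∈-upTo⁺ (s≤s a<k₂)))

Ilist-unique : ∀ k₁ k₂ → Unique (Ilist k₁ k₂)
Ilist-unique k₁ k₂ = Unique.++⁺ (Unique.map⁺ ℤ.-[1+-injective (Unique.upTo⁺ k₂))
                                (Unique.map⁺ (suc-injective ∘ ℤ.+-injective) (Unique.upTo⁺ k₁))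
                                negatives-disjoint-positives
  where
  negatives-disjoint-positives : Disjoint (map -[1+_] (upTo k₂)) (map (λ a → + suc a) (upTo k₁))
  negatives-disjoint-positives (i∈neg , i∈pos) with ∈-map⁻ -[1+_] i∈neg | ∈-map⁻ (λ a → + suc a) i∈pos
  ... | _ , _ , refl | _ , _ , ()

module _ (k₁ k₂ : ℕ) where

  ∈Ipairs⁺ : ∀ {i j} → i ∈ Ilist k₁ k₂ → j ∈ Ilist k₁ k₂ → i ℤ.≤ j → (i , j) ∈ Ipairs k₁ k₂
  ∈Ipairs⁺ {i} i∈ j∈ i≤j = ∈-concatMap⁺ _ (lose i∈ (∈-map⁺ (i ,_) (∈-filter⁺ (i ℤ.≤?_) j∈ i≤j)))

  ∈Ipairs⁻ : ∀ {i j} → (i , j) ∈ Ipairs k₁ k₂ → i ∈ Ilist k₁ k₂ × j ∈ Ilist k₁ k₂ × i ℤ.≤ j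
  ∈Ipairs⁻ ij∈ with find (∈-concatMap⁻ _ ij∈)
  ... | i , i∈ , ij∈row with ∈-map⁻ (i ,_) ij∈row
  ... | j , j∈filter , refl = i∈ , ∈-filter⁻ (i ℤ.≤?_) j∈filter

Ipairs-unique : ∀ k₁ k₂ → Unique (Ipairs k₁ k₂)
Ipairs-unique k₁ k₂ =
  Unique.concat⁺ (All.map⁺ (All.universal row-unique (Ilist k₁ k₂)))
                 (AllPairs.map⁺ (AllPairs.map rows-disjoint (Ilist-unique k₁ k₂)))
  where
  row : ℤ → List (ℤ × ℤ)
  row i = map (i ,_) (filter (i ℤ.≤?_) (Ilist k₁ k₂))
  row-unique : ∀ i → Unique (row i)
  row-unique i = Unique.map⁺ (cong proj₂) (Unique.filter⁺ (i ℤ.≤?_) (Ilist-unique k₁ k₂))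
  ∈row⇒proj₁ : ∀ {i p} → p ∈ row i → proj₁ p ≡ i
  ∈row⇒proj₁ {i} p∈ with ∈-map⁻ (i ,_) p∈
  ... | _ , _ , refl = refl
  rows-disjoint : ∀ {i j} → i ≢ j → Disjoint (row i) (row j)
  rows-disjoint i≢j (p∈i , p∈j) = i≢j (trans (sym (∈row⇒proj₁ p∈i)) (∈row⇒proj₁ p∈j))

module Summands {N : ℕ} (G : FinAbGroup N) {n : ℕ} (t : Fin n → Fin N) (k₁ k₂ : ℕ) where
  open FinAbGroup G
  open Setting G t renaming (_^_ to _^ᵍ_)

  data Summand : Set where
    unit : Summand
    pow  : Fin n → ℤ → Summand
    mul  : Fin n → Fin n → ℤ → ℤ → Summand

  eval : Summand → Fin N
  eval unit          = e
  eval (pow a k)     = t a ^ᵍ k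
  eval (mul a b k l) = (t a ^ᵍ k) ∙ (t b ^ᵍ l)

  IsSummand : Summand → Set
  IsSummand unit          = ⊤
  IsSummand (pow a k)     = k ∈ Ilist k₁ k₂
  IsSummand (mul a b k l) = a Fin.< b × k ∈ Ilist k₁ k₂ × l ∈ Ilist k₁ k₂

  mulsWith : Fin n → Fin n → ℤ → List Summand
  mulsWith a b k = map (mul a b k) (Ilist k₁ k₂)

  mulsOf : Fin n → Fin n → List Summand
  mulsOf a b = concatMap (mulsWith a b) (Ilist k₁ k₂)

  mulsAbove : Fin n → List Summand
  mulsAbove a = concatMap (mulsOf a) (filter (a <?_) (allFin n))

  powSummands mulSummands summands : List Summand
  powSummands = concatMap (λ a → map (pow a) (Ilist k₁ k₂)) (allFin n)
  mulSummands = concatMap mulsAbove (allFin n)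
  summands    = unit ∷ (powSummands ++ mulSummands)

  map-eval-summands : map eval summands ≡ tilingTerms k₁ k₂
  map-eval-summands = cong (e ∷_) (trans (map-++ eval powSummands mulSummands)
    (cong₂ _++_ (map-concatMap-cong eval (λ _ → sym (map-∘ (Ilist k₁ k₂))) (allFin n))
                (map-concatMap-cong eval (λ a → map-concatMap-cong eval (λ b →
                   map-concatMap-cong eval (λ _ → sym (map-∘ (Ilist k₁ k₂))) (Ilist k₁ k₂))
                   (filter (a <?_) (allFin n))) (allFin n))))

  IsSummand⇒∈ : ∀ {u} → IsSummand u → u ∈ summands
  IsSummand⇒∈ {unit}        _               = here refl
  IsSummand⇒∈ {pow a k}     k∈              =
    there (∈-++⁺ˡ (∈-concatMap⁺ _ (lose (∈-allFin a) (∈-map⁺ (pow a) k∈))))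
  IsSummand⇒∈ {mul a b k l} (a<b , k∈ , l∈) =
    there (∈-++⁺ʳ powSummands (∈-concatMap⁺ _ (lose (∈-allFin a)
      (∈-concatMap⁺ _ (lose (∈-filter⁺ (a <?_) (∈-allFin b) a<b)
        (∈-concatMap⁺ _ (lose k∈ (∈-map⁺ (mul a b k) l∈))))))))

  ∈⇒IsSummand : ∀ {u} → u ∈ summands → IsSummand u
  ∈⇒IsSummand (here refl) = tt
  ∈⇒IsSummand (there u∈) with ∈-++⁻ powSummands u∈
  ... | inj₁ u∈pow
    with a , _ , u∈row ← find (∈-concatMap⁻ (λ a → map (pow a) (Ilist k₁ k₂)) {allFin n} u∈pow)
    with _ , k∈ , refl ← ∈-map⁻ (pow a) u∈row
    = k∈
  ... | inj₂ u∈mul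
    with a , _ , u∈a ← find (∈-concatMap⁻ mulsAbove {allFin n} u∈mul)
    with b , b∈ , u∈ab ← find (∈-concatMap⁻ (mulsOf a) {filter (a <?_) (allFin n)} u∈a)
    with k , k∈ , u∈abk ← find (∈-concatMap⁻ (mulsWith a b) {Ilist k₁ k₂} u∈ab)
    with l , l∈ , refl ← ∈-map⁻ (mul a b k) u∈abk
    = proj₂ (∈-filter⁻ (a <?_) {xs = allFin n} b∈) , k∈ , l∈

module Tiling {N : ℕ} (G : FinAbGroup N) {n : ℕ} (t : Fin n → Fin N) (k₁ k₂ : ℕ)
  (tiles : Setting.tilingTerms G t k₁ k₂ ↭ allFin N) where
  open FinAbGroup G
  open IsAbelianGroup isAbelianGroup using (comm)
  open Setting G t renaming (_^_ to _^ᵍ_)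
  open Summands G t k₁ k₂

  eval-injective : ∀ {u v} → IsSummand u → IsSummand v → eval u ≡ eval v → u ≡ v
  eval-injective su sv = Unique-map⇒injectiveOn eval map-eval-unique (IsSummand⇒∈ su) (IsSummand⇒∈ sv)
    where
    map-eval-unique : Unique (map eval summands)
    map-eval-unique = subst Unique (sym map-eval-summands) (Unique-resp-↭ (↭-sym tiles) (Unique.allFin⁺ N))

  eval-surjective : ∀ x → ∃ λ u → IsSummand u × eval u ≡ x
  eval-surjective x
    with u , u∈ , x≡ ← ∈-map⁻ eval
           (subst (x ∈_) (sym map-eval-summands) (∈-resp-↭ (↭-sym tiles) (∈-allFin x)))
    = u , ∈⇒IsSummand u∈ , sym x≡

  mul-summand : ∀ {a b k l} → a ≢ b → k ∈ Ilist k₁ k₂ → l ∈ Ilist k₁ k₂ →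
    ∃ λ u → IsSummand u × eval u ≡ (t a ^ᵍ k) ∙ (t b ^ᵍ l) × (u ≡ mul a b k l ⊎ u ≡ mul b a l k)
  mul-summand {a} {b} {k} {l} a≢b k∈ l∈ with Fin.<-cmp a b
  ... | tri< a<b _ _ = mul a b k l , (a<b , k∈ , l∈) , refl , inj₁ refl
  ... | tri≈ _ a≡b _ = ⊥-elim (a≢b a≡b)
  ... | tri> _ _ b<a = mul b a l k , (b<a , l∈ , k∈) , comm _ _ , inj₂ refl

  InTpow⇒pow : ∀ {w i} → IsSummand w → i ∈ Ilist k₁ k₂ → InTpow i (eval w) → ∃ λ a → w ≡ pow a i
  InTpow⇒pow sw i∈ (a , eq) = a , eval-injective sw i∈ (sym eq)

  InS⇒mul : ∀ {w i j} → IsSummand w → i ∈ Ilist k₁ k₂ → j ∈ Ilist k₁ k₂ → InS i j (eval w) →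
    ∃₂ λ a b → w ≡ mul a b i j ⊎ w ≡ mul b a j i
  InS⇒mul sw i∈ j∈ (a , b , a≢b , eq)
    with u , su , eu , u≡ ← mul-summand a≢b i∈ j∈
    with refl ← eval-injective sw su (trans (sym eq) (sym eu))
    = a , b , u≡

  powClassCount mulClassCount classCount : Fin N → ℕ
  powClassCount x = length (filter (λ i → inTpow? i x) (Ilist k₁ k₂))
  mulClassCount x = length (filter (λ p → inS? (proj₁ p) (proj₂ p) x) (Ipairs k₁ k₂))
  classCount    x = indicator (x Fin.≟ e) + powClassCount x + mulClassCount x

  eval≢e : ∀ {w} → IsSummand w → w ≢ unit → eval w ≢ e
  eval≢e sw w≢unit = w≢unit ∘ eval-injective sw tt

  powClassCount-nonpow : ∀ {w} → IsSummand w → (∀ {a i} → w ≢ pow a i) → powClassCount (eval w) ≡ 0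
  powClassCount-nonpow sw w≢pow = length-filter-none _ λ i∈ w∈ → w≢pow (proj₂ (InTpow⇒pow sw i∈ w∈))

  mulClassCount-nonmul : ∀ {w} → IsSummand w → (∀ {a b i j} → w ≢ mul a b i j) → mulClassCount (eval w) ≡ 0
  mulClassCount-nonmul {w} sw w≢mul = length-filter-none _ not-in
    where
    not-in : ∀ {p} → p ∈ Ipairs k₁ k₂ → ¬ InS (proj₁ p) (proj₂ p) (eval w)
    not-in ij∈ w∈ with i∈ , j∈ , _ ← ∈Ipairs⁻ k₁ k₂ ij∈ with InS⇒mul sw i∈ j∈ w∈
    ... | _ , _ , inj₁ w≡ = w≢mul w≡
    ... | _ , _ , inj₂ w≡ = w≢mul w≡

  powClassCount-pow : ∀ {a k} → IsSummand (pow a k) → powClassCount (t a ^ᵍ k) ≡ 1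
  powClassCount-pow {a} {k} sw = length-filter-unique _ (Ilist-unique k₁ k₂) sw (a , refl) only
    where
    only : ∀ {i} → i ∈ Ilist k₁ k₂ → InTpow i (t a ^ᵍ k) → i ≡ k
    only i∈ w∈ with _ , refl ← InTpow⇒pow sw i∈ w∈ = refl

  mulClassCount-mul : ∀ {a b k l} → IsSummand (mul a b k l) → mulClassCount ((t a ^ᵍ k) ∙ (t b ^ᵍ l)) ≡ 1
  mulClassCount-mul {a} {b} {k} {l} sw@(a<b , k∈ , l∈) with k ℤ.≤? l
  ... | yes k≤l = length-filter-unique _ (Ipairs-unique k₁ k₂) (∈Ipairs⁺ k₁ k₂ k∈ l∈ k≤l)
                    (a , b , Fin.<⇒≢ a<b , refl) only
    where
    only : ∀ {p} → p ∈ Ipairs k₁ k₂ → InS (proj₁ p) (proj₂ p) (eval (mul a b k l)) → p ≡ (k , l)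
    only ij∈ w∈ with i∈ , j∈ , i≤j ← ∈Ipairs⁻ k₁ k₂ ij∈ with InS⇒mul sw i∈ j∈ w∈
    ... | _ , _ , inj₁ refl = refl
    ... | _ , _ , inj₂ refl = cong₂ _,_ (ℤ.≤-antisym i≤j k≤l) (ℤ.≤-antisym k≤l i≤j)
  ... | no k≰l = length-filter-unique _ (Ipairs-unique k₁ k₂)
                    (∈Ipairs⁺ k₁ k₂ l∈ k∈ (ℤ.<⇒≤ (ℤ.≰⇒> k≰l)))
                    (b , a , Fin.<⇒≢ a<b ∘ sym , comm _ _) only
    where
    only : ∀ {p} → p ∈ Ipairs k₁ k₂ → InS (proj₁ p) (proj₂ p) (eval (mul a b k l)) → p ≡ (l , k)
    only ij∈ w∈ with i∈ , j∈ , i≤j ← ∈Ipairs⁻ k₁ k₂ ij∈ with InS⇒mul sw i∈ j∈ w∈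
    ... | _ , _ , inj₁ refl = ⊥-elim (k≰l i≤j)
    ... | _ , _ , inj₂ refl = refl

  classCount-summand : ∀ {w} → IsSummand w → classCount (eval w) ≡ 1
  classCount-summand {unit} sw =
    cong₂ _+_ (cong₂ _+_ (indicator-yes refl (e Fin.≟ e)) (powClassCount-nonpow sw λ ()))
              (mulClassCount-nonmul sw λ ())
  classCount-summand {pow a k} sw =
    cong₂ _+_ (cong₂ _+_ (indicator-no (eval≢e sw λ ()) _) (powClassCount-pow sw))
              (mulClassCount-nonmul sw λ ())
  classCount-summand {mul a b k l} sw =
    cong₂ _+_ (cong₂ _+_ (indicator-no (eval≢e sw λ ()) _) (powClassCount-nonpow sw λ ()))
              (mulClassCount-mul sw)

  classCount≡1 : ∀ x → classCount x ≡ 1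
  classCount≡1 x with w , sw , refl ← eval-surjective x = classCount-summand sw

  ψ₂-offDiagonal : ∀ i j → InI k₁ k₂ i → InI k₁ k₂ j → i ≢ j → ψ₂ i j ≡ 0
  ψ₂-offDiagonal i j Ii Ij i≢j = length-filter-none _ not-in
    where
    not-in : ∀ {c} → c ∈ allFin n → ¬ InTpow j (t c ^ᵍ i)
    not-in {c} _ c∈ with _ , refl ← InTpow⇒pow {pow c i} (InI⇒∈Ilist Ii) (InI⇒∈Ilist Ij) c∈ = i≢j refl

  ψ₃-vanishes : ∀ m i j → InI k₁ k₂ m → InI k₁ k₂ i → InI k₁ k₂ j → ψ₃ m i j ≡ 0
  ψ₃-vanishes m i j Im Ii Ij = length-filter-none _ not-in
    where
    not-in : ∀ {c} → c ∈ allFin n → ¬ InS i j (t c ^ᵍ m)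
    not-in {c} _ c∈ with InS⇒mul {pow c m} (InI⇒∈Ilist Im) (InI⇒∈Ilist Ii) (InI⇒∈Ilist Ij) c∈
    ... | _ , _ , inj₁ ()
    ... | _ , _ , inj₂ ()

  ψ-sum : ∀ m → ψ₀ m + sum (map (ψ₂ m) (Ilist k₁ k₂))
                + sum (map (λ p → ψ₃ m (proj₁ p) (proj₂ p)) (Ipairs k₁ k₂)) ≡ n
  ψ-sum m = begin
    ψ₀ m + sum (map (ψ₂ m) (Ilist k₁ k₂)) + sum (map (λ p → ψ₃ m (proj₁ p) (proj₂ p)) (Ipairs k₁ k₂))
      ≡⟨ cong₂ _+_ (cong₂ _+_ (length-filter≡sum-indicator (λ c → tᵐ c Fin.≟ e) (allFin n))
                              (sum-length-filter-comm (λ i c → inTpow? i (tᵐ c)) (Ilist k₁ k₂) (allFin n)))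
                   (sum-length-filter-comm (λ p c → inS? (proj₁ p) (proj₂ p) (tᵐ c)) (Ipairs k₁ k₂) (allFin n)) ⟩
    sum (map isE (allFin n)) + sum (map (powClassCount ∘ tᵐ) (allFin n)) + sum (map (mulClassCount ∘ tᵐ) (allFin n))
      ≡⟨ cong (_+ sum (map (mulClassCount ∘ tᵐ) (allFin n))) (sum-map-+ isE (powClassCount ∘ tᵐ) (allFin n)) ⟨
    sum (map (λ c → isE c + powClassCount (tᵐ c)) (allFin n)) + sum (map (mulClassCount ∘ tᵐ) (allFin n))
      ≡⟨ sum-map-+ (λ c → isE c + powClassCount (tᵐ c)) (mulClassCount ∘ tᵐ) (allFin n) ⟨
    sum (map (classCount ∘ tᵐ) (allFin n))
      ≡⟨ sum-map-one (classCount≡1 ∘ tᵐ) (allFin n) ⟩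
    length (allFin n)
      ≡⟨ length-tabulate id ⟩
    n ∎
    where
    open ≡-Reasoning
    tᵐ : Fin n → Fin N
    tᵐ c = t c ^ᵍ m
    isE : Fin n → ℕ
    isE c = indicator (tᵐ c Fin.≟ e)

lemma2p3 : (k₁ k₂ n N : ℕ) → k₂ < k₁ → Composite (k₁ + k₂ + 1) →
    N ≡ 1 + n * (k₁ + k₂) + (n C 2) * (k₁ + k₂) ^ 2 →
    (G : FinAbGroup N) → (t : Fin n → Fin N) → Injective _≡_ _≡_ t →
    Setting.tilingTerms G t k₁ k₂ ↭ allFin N →
    ((i j : ℤ) → InI k₁ k₂ i → InI k₁ k₂ j → i ≢ j → Setting.ψ₂ G t i j ≡ 0)
    × ((m i j : ℤ) → InI k₁ k₂ m → InI k₁ k₂ i → InI k₁ k₂ j → Setting.ψ₃ G t m i j ≡ 0)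
    × ((m : ℤ) → Setting.ψ₀ G t m + sum (map (Setting.ψ₂ G t m) (Ilist k₁ k₂))
    + sum (map (λ p → Setting.ψ₃ G t m (proj₁ p) (proj₂ p)) (Ipairs k₁ k₂)) ≡ n)
lemma2p3 k₁ k₂ n N _ _ _ G t _ tiles = ψ₂-offDiagonal , ψ₃-vanishes , ψ-sum
  where open Tiling G t k₁ k₂ tiles
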